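{- There is no odd prime $q$, integer $k\ge1$ and nonzero integer $d$ with $v_q(d)<k$ such that $$\{x^2-dy^2\bmod q^k:(x,y)\in\mathbb{Z}^2\}=\{z^2\bmod q^k:z\in\mathbb{Z}\}.$$
   Context: $v_q$ denotes the $q$-adic valuation. -}

module Defs where

open import Data.Nat using (ℕ)
open import Data.Integer using (ℤ; _-_; _*_; +_)
open import Data.Integer.Divisibility using (_∣_)
open import Data.Nat.Primality using (Prime)
open import Data.Product using (Σ; ∃; _×_)
open import Relation.Binary.PropositionalEquality using (_≡_)
open import Relation.Nullary using (¬_)
open import Function.Bundles using (_⇔_)

_≡_[mod_] : ℤ → ℤ → ℤ → Set
a ≡ b [mod m ] = m ∣ (a - b)

InNormSet : ℤ → ℤ → ℤ → Set
InNormSet m d r = Σ ℤ λ x → Σ ℤ λ y → r ≡ (x * x - d * (y * y)) [mod m ]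

InSquareSet : ℤ → ℤ → Set
InSquareSet m r = Σ ℤ λ z → r ≡ z * z [mod m ]

SameResidueSets : ℤ → ℤ → Set
SameResidueSets m d = (r : ℤ) → InNormSet m d r ⇔ InSquareSet m r

module Submission where

-- If the two residue sets agree modulo q^k, then -d = 0² - d·1² is a square c², and since
-- w² - d = w² - d·1² is again a norm, adding c² ≡ -d to a square keeps it a square: every
-- multiple c²n is a square modulo q^k, while q^k ∤ c² because q^k ∤ d. If q ∣ c, any square w² ≡ c²n is divisible by q, so q ∣ w, and q² cancels
-- from c, w and the modulus. If q ∤ c, reduce modulo q: the q residues c²n, being squares,
-- fall into the (q + 1)/2 classes r² with 0 ≤ r ≤ (q - 1)/2, so by pigeonhole two distinct
-- n < q give the same class, and cancelling the unit c² identifies them.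

open import Defs
open import Data.Nat as ℕ using (ℕ; zero; suc; _^_; _≥_)
import Data.Nat.Properties as ℕ
import Data.Nat.Divisibility as ℕ
open import Data.Nat.Primality using (Prime; euclidsLemma; prime⇒irreducible; prime⇒nonZero; ¬prime[1])
open import Data.Integer as ℤ using (ℤ; +_; _+_; _-_; _*_; -_; ∣_∣; 0ℤ; 1ℤ)
import Data.Integer.Properties as ℤ
import Data.Integer.DivMod as ℤ
open import Data.Integer.Divisibility using (_∣_)
open import Data.Integer.Divisibility.Signed as Signed using (divides)
open import Data.Integer.Tactic.RingSolver using (solve-∀)
open import Data.Fin using (Fin; toℕ; fromℕ<)
import Data.Fin.Properties as Fin
open import Data.Product using (∃-syntax; Σ-syntax; _,_; proj₁; proj₂)
open import Data.Sum using (_⊎_; inj₁; inj₂)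
open import Data.Empty using (⊥-elim)
open import Function.Base using (_∘_)
open import Function.Bundles using (Equivalence)
open import Level using (0ℓ)
open import Relation.Binary.Bundles using (Setoid)
import Relation.Binary.Reasoning.Setoid as SetoidReasoning
open import Relation.Binary.PropositionalEquality
open import Relation.Nullary using (¬_; yes; no)

-- a ≡ b [mod m ] unfolds to divisibility of absolute values, from which Agda cannot recover
-- a, b and m; this record wrapper keeps them inferable.
infix 4 _≋_[mod_]

record _≋_[mod_] (a b m : ℤ) : Set where
  constructor mod
  field
    m∣a-b : m Signed.∣ (a - b)

≡mod⇒≋ : ∀ {m} a b → a ≡ b [mod m ] → a ≋ b [mod m ]
≡mod⇒≋ {m} a b p = mod (Signed.∣ᵤ⇒∣ {m} {a - b} p)

≋⇒≡mod : ∀ {a b m} → a ≋ b [mod m ] → a ≡ b [mod m ]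
≋⇒≡mod (mod p) = Signed.∣⇒∣ᵤ p

*-distribˡ-minus : ∀ c x y → c * (x - y) ≡ c * x - c * y
*-distribˡ-minus = solve-∀

module _ {m : ℤ} where

  ≡⇒≋ : ∀ {a b} → a ≡ b → a ≋ b [mod m ]
  ≡⇒≋ {a} refl = mod (divides 0ℤ (trans (ℤ.+-inverseʳ a) (sym (ℤ.*-zeroˡ m))))

  ≋-refl : ∀ {a} → a ≋ a [mod m ]
  ≋-refl = ≡⇒≋ refl

  ≋-sym : ∀ {a b} → a ≋ b [mod m ] → b ≋ a [mod m ]
  ≋-sym {a} {b} (mod p) = mod (subst (m Signed.∣_) (neg-minus a b) (Signed.∣m⇒∣-m p))
    where
    neg-minus : ∀ a b → - (a - b) ≡ b - a
    neg-minus = solve-∀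

  ≋-trans : ∀ {a b c} → a ≋ b [mod m ] → b ≋ c [mod m ] → a ≋ c [mod m ]
  ≋-trans {a} {b} {c} (mod p) (mod q) =
    mod (subst (m Signed.∣_) (ℤ.+-minus-telescope a b c) (Signed.∣m∣n⇒∣m+n p q))

  ≋-+-cong : ∀ {a b c d} → a ≋ b [mod m ] → c ≋ d [mod m ] → a + c ≋ b + d [mod m ]
  ≋-+-cong {a} {b} {c} {d} (mod p) (mod q) =
    mod (subst (m Signed.∣_) (regroup a b c d) (Signed.∣m∣n⇒∣m+n p q))
    where
    regroup : ∀ a b c d → a - b + (c - d) ≡ a + c - (b + d)
    regroup = solve-∀

  ≋-neg-cong : ∀ {a b} → a ≋ b [mod m ] → - a ≋ - b [mod m ]
  ≋-neg-cong {a} {b} (mod p) = mod (subst (m Signed.∣_) (ℤ.neg-distrib-+ a (- b)) (Signed.∣m⇒∣-m p))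

  ≋-*-cong : ∀ {a b c d} → a ≋ b [mod m ] → c ≋ d [mod m ] → a * c ≋ b * d [mod m ]
  ≋-*-cong {a} {b} {c} {d} (mod p) (mod q) = mod (subst (m Signed.∣_) (regroup a b c d)
    (Signed.∣m∣n⇒∣m+n (Signed.∣m⇒∣m*n c p) (Signed.∣n⇒∣m*n b q)))
    where
    regroup : ∀ a b c d → (a - b) * c + b * (c - d) ≡ a * c - b * d
    regroup = solve-∀

≋-setoid : ℤ → Setoid 0ℓ 0ℓ
≋-setoid m = record
  { Carrier       = ℤ
  ; _≈_           = _≋_[mod m ]
  ; isEquivalence = record { refl = ≋-refl ; sym = ≋-sym ; trans = ≋-trans }
  }

module ≋-Reasoning (m : ℤ) = SetoidReasoning (≋-setoid m)

∣-resp-≋ : ∀ {m a b} → a ≋ b [mod m ] → m Signed.∣ a → m Signed.∣ b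
∣-resp-≋ {m} {a} {b} (mod m∣a-b) m∣a =
  subst (m Signed.∣_) (a-[a-b]≡b a b) (Signed.∣m∣n⇒∣m-n m∣a m∣a-b)
  where
  a-[a-b]≡b : ∀ a b → a - (a - b) ≡ b
  a-[a-b]≡b = solve-∀

≋-weaken : ∀ {n m a b} → n Signed.∣ m → a ≋ b [mod m ] → a ≋ b [mod n ]
≋-weaken n∣m (mod p) = mod (Signed.∣-trans n∣m p)

≋-*-cancelˡ : ∀ {m x y} c .{{_ : ℤ.NonZero c}} → c * x ≋ c * y [mod c * m ] → x ≋ y [mod m ]
≋-*-cancelˡ {m} {x} {y} c (mod p) =
  mod (Signed.*-cancelˡ-∣ c (subst (c * m Signed.∣_) (sym (*-distribˡ-minus c x y)) p))

≋-residue : ∀ w q .{{_ : ℕ.NonZero q}} → w ≋ + (w ℤ.%ℕ q) [mod + q ]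
≋-residue w q = mod (divides (w ℤ./ℕ q) (begin
  w - r                   ≡⟨ cong (_- r) (ℤ.a≡a%ℕn+[a/ℕn]*n w q) ⟩
  r + w ℤ./ℕ q * + q - r  ≡⟨ r+x-r≡x r (w ℤ./ℕ q * + q) ⟩
  w ℤ./ℕ q * + q          ∎))
  where
  open ≡-Reasoning
  r = + (w ℤ.%ℕ q)
  r+x-r≡x : ∀ r x → r + x - r ≡ x
  r+x-r≡x = solve-∀

neg-≋-complement : ∀ {s n} → s ℕ.≤ n → - + s ≋ + (n ℕ.∸ s) [mod + n ]
neg-≋-complement {s} {n} s≤n = mod (divides ℤ.-1ℤ (begin
  - + s - + (n ℕ.∸ s)    ≡⟨ ℤ.neg-distrib-+ (+ s) (+ (n ℕ.∸ s)) ⟨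
  - (+ s + + (n ℕ.∸ s))  ≡⟨ cong -_ s+[n∸s]≡n ⟩
  - + n                  ≡⟨ ℤ.-1*i≡-i (+ n) ⟨
  ℤ.-1ℤ * + n            ∎))
  where
  open ≡-Reasoning
  s+[n∸s]≡n : + s + + (n ℕ.∸ s) ≡ + n
  s+[n∸s]≡n = trans (sym (ℤ.pos-+ s (n ℕ.∸ s))) (cong +_ (ℕ.m+[n∸m]≡n s≤n))

prime∣*⇒∣⊎∣ : ∀ {p} a b → Prime p → + p Signed.∣ a * b → + p Signed.∣ a ⊎ + p Signed.∣ b
prime∣*⇒∣⊎∣ {p} a b pp p∣ab
  with euclidsLemma ∣ a ∣ ∣ b ∣ pp (subst (p ℕ.∣_) (ℤ.abs-* a b) (Signed.∣⇒∣ᵤ p∣ab))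
... | inj₁ p∣a = inj₁ (Signed.∣ᵤ⇒∣ {+ p} {a} p∣a)
... | inj₂ p∣b = inj₂ (Signed.∣ᵤ⇒∣ {+ p} {b} p∣b)

prime∣²⇒∣ : ∀ {p} a → Prime p → + p Signed.∣ a * a → + p Signed.∣ a
prime∣²⇒∣ a pp p∣aa with prime∣*⇒∣⊎∣ a a pp p∣aa
... | inj₁ p∣a = p∣a
... | inj₂ p∣a = p∣a

≋-*-cancelˡ-prime : ∀ {p c x y} → Prime p → ¬ (+ p Signed.∣ c) →
                    c * x ≋ c * y [mod + p ] → x ≋ y [mod + p ]
≋-*-cancelˡ-prime {p} {c} {x} {y} pp p∤c (mod p∣cx-cy)
  with prime∣*⇒∣⊎∣ c (x - y) pp (subst (+ p Signed.∣_) (sym (*-distribˡ-minus c x y)) p∣cx-cy)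
... | inj₁ p∣c   = ⊥-elim (p∤c p∣c)
... | inj₂ p∣x-y = mod p∣x-y

<⇒≉ : ∀ {i j n} → i ℕ.< j → j ℕ.< n → ¬ (+ j ≋ + i [mod + n ])
<⇒≉ {i} {j} {n} i<j j<n (mod n∣j-i) =
  ℕ.<⇒≱ (ℕ.≤-<-trans (ℕ.m∸n≤m j i) j<n) (ℕ.∣⇒≤ {{ℕ.≢-nonZero (ℕ.m>n⇒m∸n≢0 i<j)}} n∣j∸i)
  where
  n∣j∸i : n ℕ.∣ j ℕ.∸ i
  n∣j∸i = Signed.∣⇒∣ᵤ
    (subst (+ n Signed.∣_) (trans (ℤ.m-n≡m⊖n j i) (ℤ.⊖-≥ (ℕ.<⇒≤ i<j))) n∣j-i)

InSquareSet-resp : ∀ {m a b} → a ≋ b [mod m ] → InSquareSet m b → InSquareSet m a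
InSquareSet-resp a≋b (z , b≡z²) = z , ≋⇒≡mod (≋-trans a≋b (≡mod⇒≋ _ (z * z) b≡z²))

MultiplesAreSquares : ℤ → ℤ → Set
MultiplesAreSquares m a = ∀ n → InSquareSet m (a * + n)

MultiplesAreSquares-resp : ∀ {m a b} → a ≋ b [mod m ] → MultiplesAreSquares m b → MultiplesAreSquares m a
MultiplesAreSquares-resp a≋b squares n = InSquareSet-resp (≋-*-cong a≋b ≋-refl) (squares n)

MultiplesAreSquares-weaken : ∀ {n m a} → n Signed.∣ m → MultiplesAreSquares m a → MultiplesAreSquares n a
MultiplesAreSquares-weaken n∣m squares k =
  let z , ak≡z² = squares k in z , ℕ.∣-trans (Signed.∣⇒∣ᵤ n∣m) ak≡z²

module _ (h : ℕ) where

  private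
    q : ℕ
    q = suc (h ℕ.+ h)

  ≋-±-representative : ∀ w → Σ[ r ∈ Fin (suc h) ]
                         (w ≋ + toℕ r [mod + q ] ⊎ - w ≋ + toℕ r [mod + q ])
  ≋-±-representative w with w ℤ.%ℕ q ℕ.≤? h
  ... | yes s≤h = fromℕ< (ℕ.s≤s s≤h) , inj₁ (subst (λ r → w ≋ + r [mod + q ])
    (sym (Fin.toℕ-fromℕ< (ℕ.s≤s s≤h))) (≋-residue w q))
  ... | no s≰h = fromℕ< q∸s<1+h , inj₂ (subst (λ r → - w ≋ + r [mod + q ])
    (sym (Fin.toℕ-fromℕ< q∸s<1+h))
    (≋-trans (≋-neg-cong (≋-residue w q)) (neg-≋-complement (ℕ.<⇒≤ (ℤ.n%ℕd<d w q)))))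
    where
    q∸s<1+h : q ℕ.∸ w ℤ.%ℕ q ℕ.< suc h
    q∸s<1+h = ℕ.s≤s (begin
      q ℕ.∸ w ℤ.%ℕ q  ≤⟨ ℕ.∸-monoʳ-≤ q (ℕ.≰⇒> s≰h) ⟩
      q ℕ.∸ suc h     ≡⟨ ℕ.m+n∸m≡n h h ⟩
      h               ∎)
      where open ℕ.≤-Reasoning

  square-≋-representative² : ∀ w → Σ[ r ∈ Fin (suc h) ] w * w ≋ + toℕ r * + toℕ r [mod + q ]
  square-≋-representative² w with ≋-±-representative w
  ... | r , inj₁ w≋r  = r , ≋-*-cong w≋r w≋r
  ... | r , inj₂ -w≋r = r ,
    subst (λ x → x ≋ + toℕ r * + toℕ r [mod + q ]) (neg-square w) (≋-*-cong -w≋r -w≋r)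
    where
    neg-square : ∀ w → - w * - w ≡ w * w
    neg-square = solve-∀

  ¬MultiplesAreSquares-mod-1+2h : ∀ {a} .{{_ : ℕ.NonZero h}} → Prime q → ¬ (+ q Signed.∣ a) →
                                  ¬ MultiplesAreSquares (+ q) a
  ¬MultiplesAreSquares-mod-1+2h {a} pq q∤a squares =
    let i , j , i<j , root-i≡root-j = Fin.pigeonhole (ℕ.s≤s (ℕ.m<m+n h (ℕ.>-nonZero⁻¹ h))) root
    in <⇒≉ i<j (Fin.toℕ<n j) (≋-*-cancelˡ-prime pq q∤a (begin
         a * + toℕ j      ≈⟨ a*n≋root² j ⟩
         root² j          ≡⟨ cong (λ r → + toℕ r * + toℕ r) root-i≡root-j ⟨
         root² i          ≈⟨ a*n≋root² i ⟨
         a * + toℕ i      ∎))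
    where
    open ≋-Reasoning (+ q)
    root : Fin q → Fin (suc h)
    root n = proj₁ (square-≋-representative² (proj₁ (squares (toℕ n))))
    root² : Fin q → ℤ
    root² n = + toℕ (root n) * + toℕ (root n)
    a*n≋root² : ∀ n → a * + toℕ n ≋ root² n [mod + q ]
    a*n≋root² n = let w , a*n≡w² = squares (toℕ n) in
      ≋-trans (≡mod⇒≋ (a * + toℕ n) (w * w) a*n≡w²) (proj₂ (square-≋-representative² w))

even⊎odd : ∀ n → ∃[ h ] (n ≡ h ℕ.+ h ⊎ n ≡ suc (h ℕ.+ h))
even⊎odd zero = 0 , inj₁ refl
even⊎odd (suc n) with even⊎odd n
... | h , inj₁ refl = h , inj₂ refl
... | h , inj₂ refl = suc h , inj₁ (cong suc (sym (ℕ.+-suc h h)))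

n+n≡n*2 : ∀ n → n ℕ.+ n ≡ n ℕ.* 2
n+n≡n*2 n = trans (cong (n ℕ.+_) (sym (ℕ.+-identityʳ n))) (ℕ.*-comm 2 n)

prime≢2⇒odd : ∀ {q} → Prime q → q ≢ 2 → ∃[ h ] q ≡ suc (h ℕ.+ h)
prime≢2⇒odd {q} pq q≢2 with even⊎odd q
... | h , inj₂ q≡1+2h = h , q≡1+2h
... | h , inj₁ q≡2h with prime⇒irreducible pq (ℕ.divides h (trans q≡2h (n+n≡n*2 h)))
...   | inj₁ ()
...   | inj₂ 2≡q = ⊥-elim (q≢2 (sym 2≡q))

odd-prime⇒¬MultiplesAreSquares : ∀ {q a} → Prime q → q ≢ 2 → ¬ (+ q Signed.∣ a) →
                                 ¬ MultiplesAreSquares (+ q) a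
odd-prime⇒¬MultiplesAreSquares pq q≢2 with prime≢2⇒odd pq q≢2
... | zero  , refl = ⊥-elim (¬prime[1] pq)
... | suc h , refl = ¬MultiplesAreSquares-mod-1+2h (suc h) pq

+q^[2+k]≡+q*+q*+q^k : ∀ q k → + (q ^ (2 ℕ.+ k)) ≡ + q * + q * + (q ^ k)
+q^[2+k]≡+q*+q*+q^k q k = begin
  + (q ℕ.* (q ℕ.* q ^ k))   ≡⟨ ℤ.pos-* q (q ℕ.* q ^ k) ⟩
  + q * + (q ℕ.* q ^ k)     ≡⟨ cong (+ q *_) (ℤ.pos-* q (q ^ k)) ⟩
  + q * (+ q * + (q ^ k))   ≡⟨ ℤ.*-assoc (+ q) (+ q) (+ (q ^ k)) ⟨
  + q * + q * + (q ^ k)     ∎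
  where open ≡-Reasoning

[ab]²≡b²a² : ∀ a b → a * b * (a * b) ≡ b * b * (a * a)
[ab]²≡b²a² = solve-∀

q^k∣c²⇒q^[2+k]∣[cq]² : ∀ {q} k c → + (q ^ k) Signed.∣ c * c →
                       + (q ^ (2 ℕ.+ k)) Signed.∣ c * + q * (c * + q)
q^k∣c²⇒q^[2+k]∣[cq]² {q} k c q^k∣c² =
  subst₂ Signed._∣_ (sym (+q^[2+k]≡+q*+q*+q^k q k)) (sym ([ab]²≡b²a² c (+ q)))
    (Signed.*-monoʳ-∣ (+ q * + q) q^k∣c²)

≋-divide-q² : ∀ {q} k c w n .{{_ : ℕ.NonZero q}} →
              c * + q * (c * + q) * n ≋ w * + q * (w * + q) [mod + (q ^ (2 ℕ.+ k)) ] →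
              c * c * n ≋ w * w [mod + (q ^ k) ]
≋-divide-q² {q} k c w n [cq]²n≋[wq]² = ≋-*-cancelˡ (+ q * + q) {{ℤ.i*j≢0 (+ q) (+ q)}} (begin
  + q * + q * (c * c * n)   ≡⟨ regroup c (+ q) n ⟩
  c * + q * (c * + q) * n   ≈⟨ subst (λ m → c * + q * (c * + q) * n ≋ w * + q * (w * + q) [mod m ])
                                 (+q^[2+k]≡+q*+q*+q^k q k) [cq]²n≋[wq]² ⟩
  w * + q * (w * + q)       ≡⟨ [ab]²≡b²a² w (+ q) ⟩
  + q * + q * (w * w)       ∎)
  where
  open ≋-Reasoning (+ q * + q * + (q ^ k))
  regroup : ∀ c q n → q * q * (c * c * n) ≡ c * q * (c * q) * n
  regroup = solve-∀

MultiplesAreSquares-divide-q² : ∀ {q} k c → Prime q →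
                                MultiplesAreSquares (+ (q ^ (2 ℕ.+ k))) (c * + q * (c * + q)) →
                                MultiplesAreSquares (+ (q ^ k)) (c * c)
MultiplesAreSquares-divide-q² {q} k c pq squares n = divide (squares n)
  where
  instance _ = prime⇒nonZero pq
  q∣q^[2+k] : + q Signed.∣ + (q ^ (2 ℕ.+ k))
  q∣q^[2+k] = Signed.∣ᵤ⇒∣ {+ q} {+ (q ^ (2 ℕ.+ k))} (ℕ.m∣m*n (q ^ suc k))
  q∣[cq]²n : + q Signed.∣ c * + q * (c * + q) * + n
  q∣[cq]²n = Signed.∣m⇒∣m*n (+ n) (Signed.∣m⇒∣m*n (c * + q) (Signed.∣n⇒∣m*n c Signed.∣-refl))
  divide : InSquareSet (+ (q ^ (2 ℕ.+ k))) (c * + q * (c * + q) * + n) →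
           InSquareSet (+ (q ^ k)) (c * c * + n)
  divide (w , [cq]²n≡w²) = w₁ , ≋⇒≡mod (≋-divide-q² k c w₁ (+ n)
      (subst (λ w → c * + q * (c * + q) * + n ≋ w * w [mod + (q ^ (2 ℕ.+ k)) ]) w≡w₁q [cq]²n≋w²))
    where
    [cq]²n≋w² : c * + q * (c * + q) * + n ≋ w * w [mod + (q ^ (2 ℕ.+ k)) ]
    [cq]²n≋w² = ≡mod⇒≋ (c * + q * (c * + q) * + n) (w * w) [cq]²n≡w²
    open Signed._∣_ (prime∣²⇒∣ w pq (∣-resp-≋ (≋-weaken q∣q^[2+k] [cq]²n≋w²) q∣[cq]²n))
      renaming (quotient to w₁; equality to w≡w₁q)

¬MultiplesAreSquares-square : ∀ {q} k c → Prime q → q ≢ 2 → ¬ (+ (q ^ k) Signed.∣ c * c) →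
                              ¬ MultiplesAreSquares (+ (q ^ k)) (c * c)
¬MultiplesAreSquares-square zero c _ _ 1∤c² _ = 1∤c² (divides (c * c) (sym (ℤ.*-identityʳ (c * c))))
¬MultiplesAreSquares-square {q} (suc k) c pq q≢2 _ squares with + q Signed.∣? c
... | no q∤c = odd-prime⇒¬MultiplesAreSquares pq q≢2 (q∤c ∘ prime∣²⇒∣ c pq)
    (MultiplesAreSquares-weaken {a = c * c} (Signed.∣ᵤ⇒∣ {+ q} {+ (q ^ suc k)} (ℕ.m∣m*n (q ^ k))) squares)
¬MultiplesAreSquares-square {q} (suc zero) _ _ _ q∤c² _ | yes (divides c₁ refl) =
  q∤c² (Signed.∣m⇒∣m*n (c₁ * + q)
    (Signed.∣n⇒∣m*n c₁ (Signed.∣-reflexive (cong +_ (ℕ.*-identityʳ q)))))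
¬MultiplesAreSquares-square {q} (suc (suc k)) _ pq q≢2 q^[2+k]∤c² squares | yes (divides c₁ refl) =
  ¬MultiplesAreSquares-square k c₁ pq q≢2 (q^[2+k]∤c² ∘ q^k∣c²⇒q^[2+k]∣[cq]² k c₁)
    (MultiplesAreSquares-divide-q² k c₁ pq squares)

SameResidueSets⇒-d-square : ∀ m d → SameResidueSets m d → InSquareSet m (- d)
SameResidueSets⇒-d-square m d same =
  Equivalence.to (same (- d)) (0ℤ , 1ℤ , ≋⇒≡mod (≡⇒≋ {m} (sym (0²-d1²≡-d d))))
  where
  0²-d1²≡-d : ∀ d → 0ℤ * 0ℤ - d * (1ℤ * 1ℤ) ≡ - d
  0²-d1²≡-d = solve-∀

SameResidueSets⇒MultiplesAreSquares : ∀ m d → SameResidueSets m d → MultiplesAreSquares m (- d)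
SameResidueSets⇒MultiplesAreSquares m d same zero = 0ℤ , ≋⇒≡mod (≡⇒≋ {m} (ℤ.*-zeroʳ (- d)))
SameResidueSets⇒MultiplesAreSquares m d same (suc n) =
  let w , -dn≡w² = SameResidueSets⇒MultiplesAreSquares m d same n in
  InSquareSet-resp (begin
    - d * + suc n            ≡⟨ a[1+n]≡an+a (- d) (+ n) ⟩
    - d * + n + - d          ≈⟨ ≋-+-cong (≡mod⇒≋ (- d * + n) (w * w) -dn≡w²) (≋-refl {a = - d}) ⟩
    w * w + - d              ≡⟨ w²-d≡w²-d1² w d ⟩
    w * w - d * (1ℤ * 1ℤ)    ∎)
    (Equivalence.to (same (w * w - d * (1ℤ * 1ℤ)))
      (w , 1ℤ , ≋⇒≡mod (≋-refl {m} {w * w - d * (1ℤ * 1ℤ)})))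
  where
  open ≋-Reasoning m
  a[1+n]≡an+a : ∀ a n → a * (1ℤ + n) ≡ a * n + a
  a[1+n]≡an+a = solve-∀
  w²-d≡w²-d1² : ∀ w d → w * w + - d ≡ w * w - d * (1ℤ * 1ℤ)
  w²-d≡w²-d1² = solve-∀

-- The hypotheses k ≥ 1 and d ≢ 0 are implied by q^k ∤ d.
lemma3p11 : (q k : ℕ) (d : ℤ) → Prime q → ¬ (q ≡ 2) → k ≥ 1 → ¬ (d ≡ + 0)
    → ¬ ((+ (q ^ k)) ∣ d) → ¬ SameResidueSets (+ (q ^ k)) d
lemma3p11 q k d pq q≢2 _ _ q^k∤d same =
  ¬MultiplesAreSquares-square k c pq q≢2 q^k∤c²
    (MultiplesAreSquares-resp c²≋-d (SameResidueSets⇒MultiplesAreSquares (+ (q ^ k)) d same))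
  where
  c : ℤ
  c = proj₁ (SameResidueSets⇒-d-square (+ (q ^ k)) d same)
  c²≋-d : c * c ≋ - d [mod + (q ^ k) ]
  c²≋-d = ≋-sym (≡mod⇒≋ (- d) (c * c) (proj₂ (SameResidueSets⇒-d-square (+ (q ^ k)) d same)))
  q^k∤c² : ¬ (+ (q ^ k) Signed.∣ c * c)
  q^k∤c² = q^k∤d ∘ subst (q ^ k ℕ.∣_) (ℤ.∣-i∣≡∣i∣ d) ∘ Signed.∣⇒∣ᵤ ∘ ∣-resp-≋ c²≋-d
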